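{- Suppose that $1/n\ll\varepsilon_3\ll\varepsilon_4\ll\eta_2\ll1$. Let $G$ be a digraph on $n$ vertices with $\delta^0(G)\geq n/2$, and suppose $A,B,S,T$ is a partition of $V(G)$ into sets of sizes $a,b,s,t$ satisfying (P1)--(P8). Then: (i) if $a=b\in\{0,1\}$, then for any prescribed directions there are two disjoint edges between $S$ and $T$ with these directions (i.e. two disjoint $ST$-edges, two disjoint $TS$-edges, and a disjoint pair consisting of one $ST$-edge and one $TS$-edge all exist); (ii) if $A=\emptyset$, then there are two disjoint $TS$-edges; (iii) if $a=1$ and $b\geq2$, then there are two disjoint $TS$-edges; (iv) there are two disjoint edges in $E(S,T\cup A)\cup E(T,S\cup B)$.
   Context: Hierarchy notation: $1/n\ll a_1\ll\dots\ll a_k\ll1$ means there are non-decreasing functions $f_0,\dots,f_k$ such that the statement holds whenever $a_k\le f_k(1)$, $a_i\le f_i(a_{i+1})$, $1/n\le f_0(a_1)$. Digraphs have no loops and at most one edge in each direction between two vertices; $\delta^0$ is the minimum semidegree; $d^\pm_X(x)$ are the numbers of out-/inneighbours of $x$ in $X$, and $d^\pm_X(x)\ge c$ means both are $\ge c$. $E(X,Y)$ is the set of edges $xy$ with $x\in X,y\in Y$; such an edge is an $XY$-edge. Conditions: (P1) $a\le b$, $s\le t$; (P2) $\lfloor n/2\rfloor-\varepsilon_3n\le s,t\le\lceil n/2\rceil+\varepsilon_3n$; (P3) $\delta^0(G[S]),\delta^0(G[T])\ge\eta_2n$; (P4) $d^\pm_S(x)\ge n/2-\varepsilon_3n$ for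 all but at most $\varepsilon_3n$ vertices $x\in S$; (P5) the same with $T$ in place of $S$; (P6) $a+b\le\varepsilon_3n$; (P7) for all $x\in A$: $d^-_T(x),d^+_S(x)>n/2-3\eta_2n$ and $d^-_S(x),d^+_T(x)\le3\eta_2n$; (P8) for all $x\in B$: $d^-_S(x),d^+_T(x)>n/2-3\eta_2n$ and $d^-_T(x),d^+_S(x)\le3\eta_2n$.
   Formalization: The constants $\varepsilon_3$, $\varepsilon_4$, $\eta_2$ are rational, and the hierarchy functions are taken as functions from ℚ to ℚ. -}

module Defs where

open import Data.Nat as ℕ using (ℕ; zero; suc)
open import Data.Integer using (+_)
open import Data.Rational as ℚ using (ℚ; _/_; ½; 0ℚ; 1ℚ)
open import Data.Fin using (Fin)
open import Data.Fin.Subset using (Subset; ∣_∣; _⊆_)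
open import Data.Vec using (tabulate)
open import Data.Bool using (Bool; true; false; _∧_)
open import Data.Product using (Σ; ∃; _×_; _,_)
open import Data.Sum using (_⊎_)
open import Relation.Binary.PropositionalEquality using (_≡_; _≢_)

⟦_⟧ : ℕ → ℚ
⟦ n ⟧ = + n / 1

-- A digraph on vertex set Fin n: no loops; "at most one edge in each
-- direction" is automatic for a Boolean adjacency relation.
record Digraph (n : ℕ) : Set where
  field
    edge   : Fin n → Fin n → Bool
    noLoop : ∀ x → edge x x ≡ false
open Digraph public

_⇒[_]_ : ∀ {n} → Fin n → Digraph n → Fin n → Set
x ⇒[ G ] y = edge G x y ≡ true

-- Labels of the four parts of a partition A, B, S, T of V(G).
-- A partition of V(G) into (possibly empty) sets A,B,S,T is a map V(G) → Part.
data Part : Set where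
  PA PB PS PT : Part

is : Part → Part → Bool
is PA PA = true
is PB PB = true
is PS PS = true
is PT PT = true
is _  _  = false

part : ∀ {n} → (Fin n → Part) → Part → Subset n
part π p = tabulate (λ y → is p (π y))

size : ∀ {n} → (Fin n → Part) → Part → ℕ
size π p = ∣ part π p ∣

dout : ∀ {n} → Digraph n → (Fin n → Part) → Part → Fin n → ℕ
dout G π p x = ∣ tabulate (λ y → edge G x y ∧ is p (π y)) ∣

din : ∀ {n} → Digraph n → (Fin n → Part) → Part → Fin n → ℕ
din G π p x = ∣ tabulate (λ y → edge G y x ∧ is p (π y)) ∣

outdeg indeg : ∀ {n} → Digraph n → Fin n → ℕ
outdeg G x = ∣ tabulate (λ y → edge G x y) ∣
indeg  G x = ∣ tabulate (λ y → edge G y x) ∣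

MinSemideg≥half : ∀ {n} → Digraph n → Set
MinSemideg≥half {n} G = ∀ x → (⟦ n ⟧ ℚ.* ½ ℚ.≤ ⟦ outdeg G x ⟧) × (⟦ n ⟧ ℚ.* ½ ℚ.≤ ⟦ indeg G x ⟧)

Disjoint4 : ∀ {n} → Fin n → Fin n → Fin n → Fin n → Set
Disjoint4 x y u v = (x ≢ u) × (x ≢ v) × (y ≢ u) × (y ≢ v)

TwoDisjointEdges : ∀ {n} → Digraph n → (Fin n → Fin n → Set) → (Fin n → Fin n → Set) → Set
TwoDisjointEdges {n} G P Q =
  Σ (Fin n) λ x → Σ (Fin n) λ y → Σ (Fin n) λ u → Σ (Fin n) λ v →
    (x ⇒[ G ] y) × (u ⇒[ G ] v) × P x y × Q u v × Disjoint4 x y u v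

Between : ∀ {n} → (Fin n → Part) → Part → Part → Fin n → Fin n → Set
Between π p q x y = (π x ≡ p) × (π y ≡ q)

module _ {n : ℕ} (G : Digraph n) (π : Fin n → Part) (ε₃ η₂ : ℚ) where
  private
    N = ⟦ n ⟧
    a = size π PA
    b = size π PB
    s = size π PS
    t = size π PT

  P1 : Set
  P1 = (a ℕ.≤ b) × (s ℕ.≤ t)

  P2 : Set
  P2 = (⟦ n ℕ./ 2 ⟧ ℚ.- ε₃ ℚ.* N ℚ.≤ ⟦ s ⟧) × (⟦ s ⟧ ℚ.≤ ⟦ (suc n) ℕ./ 2 ⟧ ℚ.+ ε₃ ℚ.* N)
     × (⟦ n ℕ./ 2 ⟧ ℚ.- ε₃ ℚ.* N ℚ.≤ ⟦ t ⟧) × (⟦ t ⟧ ℚ.≤ ⟦ (suc n) ℕ./ 2 ⟧ ℚ.+ ε₃ ℚ.* N)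

  P3 : Set
  P3 = (∀ x → π x ≡ PS → (η₂ ℚ.* N ℚ.≤ ⟦ dout G π PS x ⟧) × (η₂ ℚ.* N ℚ.≤ ⟦ din G π PS x ⟧))
     × (∀ x → π x ≡ PT → (η₂ ℚ.* N ℚ.≤ ⟦ dout G π PT x ⟧) × (η₂ ℚ.* N ℚ.≤ ⟦ din G π PT x ⟧))

  -- "d^±_X(x) ≥ n/2 - ε₃ n for all but at most ε₃ n vertices x ∈ X":
  -- there is an exceptional set E of at most ε₃ n vertices outside of which
  -- every vertex of X satisfies the bound.
  AllButFew : Part → Set
  AllButFew p = Σ (Subset n) λ E → (⟦ ∣ E ∣ ⟧ ℚ.≤ ε₃ ℚ.* N) ×
    (∀ x → π x ≡ p → Data.Fin.Subset._∉_ x E →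
       (N ℚ.* ½ ℚ.- ε₃ ℚ.* N ℚ.≤ ⟦ dout G π p x ⟧) × (N ℚ.* ½ ℚ.- ε₃ ℚ.* N ℚ.≤ ⟦ din G π p x ⟧))

  P4 : Set
  P4 = AllButFew PS

  P5 : Set
  P5 = AllButFew PT

  P6 : Set
  P6 = ⟦ a ℕ.+ b ⟧ ℚ.≤ ε₃ ℚ.* N

  P7 : Set
  P7 = ∀ x → π x ≡ PA →
         (N ℚ.* ½ ℚ.- ⟦ 3 ⟧ ℚ.* η₂ ℚ.* N ℚ.< ⟦ din G π PT x ⟧)
       × (N ℚ.* ½ ℚ.- ⟦ 3 ⟧ ℚ.* η₂ ℚ.* N ℚ.< ⟦ dout G π PS x ⟧)
       × (⟦ din G π PS x ⟧ ℚ.≤ ⟦ 3 ⟧ ℚ.* η₂ ℚ.* N)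
       × (⟦ dout G π PT x ⟧ ℚ.≤ ⟦ 3 ⟧ ℚ.* η₂ ℚ.* N)

  P8 : Set
  P8 = ∀ x → π x ≡ PB →
         (N ℚ.* ½ ℚ.- ⟦ 3 ⟧ ℚ.* η₂ ℚ.* N ℚ.< ⟦ din G π PS x ⟧)
       × (N ℚ.* ½ ℚ.- ⟦ 3 ⟧ ℚ.* η₂ ℚ.* N ℚ.< ⟦ dout G π PT x ⟧)
       × (⟦ din G π PT x ⟧ ℚ.≤ ⟦ 3 ⟧ ℚ.* η₂ ℚ.* N)
       × (⟦ dout G π PS x ⟧ ℚ.≤ ⟦ 3 ⟧ ℚ.* η₂ ℚ.* N)

  P1-8 : Set
  P1-8 = P1 × P2 × P3 × P4 × P5 × P6 × P7 × P8

-- Hierarchy functions: non-decreasing maps (0,1] → (0,1], rendered on ℚ.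
Positive : ℚ → Set
Positive x = 0ℚ ℚ.< x

HierFun : (ℚ → ℚ) → Set
HierFun f = (∀ x → Positive x → Positive (f x))
          × (∀ x y → Positive x → x ℚ.≤ y → f x ℚ.≤ f y)

-- Every vertex has at least n/2 out- and in-neighbours, fewer than |X| of them inside its own
-- part X.  For x ∈ S this leaves the budget  a + b + t + 2 ≤ s + 2 (d_A(x) + d_B(x) + d_T(x)),
-- and symmetrically for T, so a vertex with few neighbours in A ∪ B has many across.  By (P7)
-- and (P8) the vertices of A and B have at most 3n/100 neighbours on their sparse side, and
-- double counting shows that all but 12n/100 vertices of S (and of T) are light, i.e. have few
-- neighbours in A or in B; as s, t ≈ n/2 there are at least three light vertices.  Two light
-- vertices with two neighbours across give the two disjoint edges; when s = t they are only
-- guaranteed one, and a third light vertex repairs a collision.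

module Submission where

open import Defs
open import Data.Nat
open import Data.Nat.Properties
open import Data.Nat.Tactic.RingSolver using (solve; solve-∀)
open import Data.Bool using (Bool; true; false; _∧_; _∨_; not; T)
open import Data.Bool.Properties using (∧-identityʳ; ∧-zeroʳ; ∧-assoc; ∧-comm; ∧-conicalˡ; ∧-conicalʳ)
open import Data.Fin using (Fin; zero; suc)
open import Data.Fin.Properties using () renaming (_≟_ to _≟ᶠ_)
open import Data.Fin.Subset using (∣_∣)
open import Data.Vec using (tabulate)
open import Data.List using (_∷_; [])
open import Data.Product using (Σ; ∃-syntax; _×_; _,_; proj₁; proj₂)
open import Data.Sum using (_⊎_; inj₁; inj₂; [_,_]′)
open import Data.Empty using (⊥; ⊥-elim)
open import Data.Rational using (ℚ; 1ℚ; ½) renaming (_≤_ to _≤ℚ_; _*_ to _*ℚ_)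
import Data.Rational.Properties as ℚ
open import Function using (id; const; flip; _∘_)
open import Relation.Binary using (tri<; tri≈; tri>)
open import Relation.Binary.PropositionalEquality
open import Relation.Nullary using (does; yes; no)
open import Relation.Nullary.Negation using (contradiction)
open import Algebra.Properties.Semiring.Sum +-*-semiring
  using (sum; ∑-comm; ∑-distrib-+; sum-cong-≗; sum-replicate-zero; *-distribˡ-sum)
open import Algebra.Properties.CommutativeSemigroup +-commutativeSemigroup using (xy∙z≈xz∙y)
open import Algebra.Properties.CommutativeSemigroup *-commutativeSemigroup
  using () renaming (x∙yz≈y∙xz to *-exchange)

-- Counting

indicator : Bool → ℕ
indicator true  = 1
indicator false = 0

count : ∀ {n} → (Fin n → Bool) → ℕ
count f = sum (indicator ∘ f)

∣tabulate∣≡count : ∀ {n} (f : Fin n → Bool) → ∣ tabulate f ∣ ≡ count f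
∣tabulate∣≡count {zero}  f = refl
∣tabulate∣≡count {suc n} f with f zero
... | true  = cong suc (∣tabulate∣≡count (f ∘ suc))
... | false = ∣tabulate∣≡count (f ∘ suc)

sum-mono-≤ : ∀ {n} {f g : Fin n → ℕ} → (∀ i → f i ≤ g i) → sum f ≤ sum g
sum-mono-≤ {zero}  f≤g = z≤n
sum-mono-≤ {suc n} f≤g = +-mono-≤ (f≤g zero) (sum-mono-≤ (f≤g ∘ suc))

count-true : ∀ n → count {n} (λ _ → true) ≡ n
count-true zero    = refl
count-true (suc n) = cong suc (count-true n)

indicator-mono : ∀ a b → (a ≡ true → b ≡ true) → indicator a ≤ indicator b
indicator-mono true  b a⇒b rewrite a⇒b refl = ≤-refl
indicator-mono false b a⇒b = z≤n

count-mono : ∀ {n} {f g : Fin n → Bool} → (∀ i → f i ≡ true → g i ≡ true) → count f ≤ count g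
count-mono {f = f} {g} f⊆g = sum-mono-≤ λ i → indicator-mono (f i) (g i) (f⊆g i)

count-∧-not : ∀ {n} (f g : Fin n → Bool) → count f ≡ count (λ i → f i ∧ g i) + count (λ i → f i ∧ not (g i))
count-∧-not f g = trans (sum-cong-≗ λ i → split (f i) (g i))
                        (∑-distrib-+ (λ i → indicator (f i ∧ g i)) (λ i → indicator (f i ∧ not (g i))))
  where
  split : ∀ a b → indicator a ≡ indicator (a ∧ b) + indicator (a ∧ not b)
  split true  true  = refl
  split true  false = refl
  split false b     = refl

count-witness : ∀ {n} (f : Fin n → Bool) → 1 ≤ count f → ∃[ i ] f i ≡ true
count-witness {suc n} f h with f zero in fz
... | true  = zero , fz
... | false = let i , fi = count-witness (f ∘ suc) h in suc i , fi

_∖_ : ∀ {n} → (Fin n → Bool) → Fin n → Fin n → Bool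
(f ∖ j) i = f i ∧ not (does (i ≟ᶠ j))

∖-true : ∀ {n} (f : Fin n → Bool) {i j} → (f ∖ j) i ≡ true → f i ≡ true × i ≢ j
∖-true f {i} {j} e with f i | i ≟ᶠ j
... | true | no i≢j = refl , i≢j

count-∖ : ∀ {n} (f : Fin n → Bool) j → count f ≤ suc (count (f ∖ j))
count-∖ {suc n} f zero rewrite ∧-zeroʳ (f zero) =
  +-mono-≤ (indicator≤1 (f zero)) (≤-reflexive (sum-cong-≗ λ i → cong indicator (sym (∧-identityʳ (f (suc i))))))
  where
  indicator≤1 : ∀ b → indicator b ≤ 1
  indicator≤1 true  = ≤-refl
  indicator≤1 false = z≤n
count-∖ {suc n} f (suc j) rewrite ∧-identityʳ (f zero) with f zero
... | true  = s≤s (count-∖ (f ∘ suc) j)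
... | false = count-∖ (f ∘ suc) j

count-witness-≢ : ∀ {n} (f : Fin n → Bool) → 2 ≤ count f → ∀ j → ∃[ i ] f i ≡ true × i ≢ j
count-witness-≢ f h j =
  let i , fi = count-witness (f ∖ j) (s≤s⁻¹ (≤-trans h (count-∖ f j))) in i , ∖-true f fi

count-witness₂ : ∀ {n} (f : Fin n → Bool) → 2 ≤ count f → ∃[ i ] ∃[ j ] f i ≡ true × f j ≡ true × i ≢ j
count-witness₂ f h =
  let i , fi = count-witness f (≤-trans (s≤s z≤n) h)
      j , fj , j≢i = count-witness-≢ f h i
  in i , j , fi , fj , j≢i ∘ sym

count-witness-≢₂ : ∀ {n} (f : Fin n → Bool) → 3 ≤ count f → ∀ j j′ → ∃[ i ] f i ≡ true × i ≢ j × i ≢ j′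
count-witness-≢₂ f h j j′ =
  let i , fi , i≢j′ = count-witness-≢ (f ∖ j) (s≤s⁻¹ (≤-trans h (count-∖ f j))) j′
      fi , i≢j = ∖-true f fi
  in i , fi , i≢j , i≢j′

count-< : ∀ {n} {f g : Fin n → Bool} → (∀ i → f i ≡ true → g i ≡ true) →
          ∀ j → f j ≡ false → g j ≡ true → count f < count g
count-< {f = f} {g} f⊆g zero fj gj rewrite fj | gj = s≤s (count-mono (f⊆g ∘ suc))
count-< {f = f} {g} f⊆g (suc j) fj gj =
  ≤-trans (≤-reflexive (sym (+-suc (indicator (f zero)) _)))
          (+-mono-≤ (indicator-mono (f zero) (g zero) (f⊆g zero)) (count-< (f⊆g ∘ suc) j fj gj))

count-markov : ∀ {n} (f : Fin n → Bool) (g : Fin n → ℕ) k →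
               (∀ i → f i ≡ true → k ≤ g i) → k * count f ≤ sum g
count-markov f g k f⇒k≤g = begin
  k * count f                  ≡⟨ *-distribˡ-sum k (indicator ∘ f) ⟩
  sum (λ i → k * indicator (f i)) ≤⟨ sum-mono-≤ pointwise ⟩
  sum g                        ∎
  where
  open ≤-Reasoning
  pointwise : ∀ i → k * indicator (f i) ≤ g i
  pointwise i with f i in fi
  ... | true  = ≤-trans (≤-reflexive (*-identityʳ k)) (f⇒k≤g i fi)
  ... | false = ≤-trans (≤-reflexive (*-zeroʳ k)) z≤n

sum≤count : ∀ {n} (f : Fin n → Bool) (g : Fin n → ℕ) c C →
            (∀ i → c * g i ≤ C * indicator (f i)) → c * sum g ≤ C * count f
sum≤count f g c C bound = begin
  c * sum g                        ≡⟨ *-distribˡ-sum c g ⟩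
  sum (λ i → c * g i)              ≤⟨ sum-mono-≤ bound ⟩
  sum (λ i → C * indicator (f i))  ≡⟨ *-distribˡ-sum C (indicator ∘ f) ⟨
  C * count f                      ∎
  where open ≤-Reasoning

-- Linear arithmetic

exclude-own-part : ∀ {a b p q dA dB dp dq} → a + b + p + q ≤ 2 * (dA + dB + dp + dq) → dp < p →
               a + b + q + 2 ≤ p + 2 * (dA + dB + dq)
exclude-own-part {a} {b} {p} {q} {dA} {dB} {dp} {dq} total dp<p = +-cancelˡ-≤ p _ _ (begin
  p + (a + b + q + 2)               ≡⟨ solve (a ∷ b ∷ p ∷ q ∷ []) ⟩
  a + b + p + q + 2                 ≤⟨ +-monoˡ-≤ 2 total ⟩
  2 * (dA + dB + dp + dq) + 2       ≡⟨ solve (dA ∷ dB ∷ dp ∷ dq ∷ []) ⟩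
  2 * suc dp + 2 * (dA + dB + dq)   ≤⟨ +-monoˡ-≤ _ (*-monoʳ-≤ 2 dp<p) ⟩
  2 * p + 2 * (dA + dB + dq)        ≡⟨ solve (p ∷ dA ∷ dB ∷ dq ∷ []) ⟩
  p + (p + 2 * (dA + dB + dq))      ∎)
  where open ≤-Reasoning

excess⇒1≤ : ∀ {u v d} → u + 2 ≤ v + 2 * d → v ≤ u → 1 ≤ d
excess⇒1≤ {u} {v} {zero} h v≤u with +-cancelˡ-≤ u 2 0 (≤-trans h (+-monoˡ-≤ 0 v≤u))
... | ()
excess⇒1≤ {d = suc d} _ _ = s≤s z≤n

excess⇒2≤ : ∀ {u v d} → u + 2 ≤ v + 2 * d → v < u → 2 ≤ d
excess⇒2≤ {u} {v} {zero} h v<u = contradiction (excess⇒1≤ {d = 0} h (<⇒≤ v<u)) λ ()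
excess⇒2≤ {u} {v} {suc zero} h v<u = contradiction (+-cancelʳ-≤ 2 u v h) (<⇒≱ v<u)
excess⇒2≤ {d = suc (suc d)} _ _ = s≤s (s≤s z≤n)

balanced-budget : ∀ {a b p q dA dB dq} → dA + dB ≤ a → a ≡ b →
                  a + b + q + 2 ≤ p + 2 * (dA + dB + dq) → q + 2 ≤ p + 2 * dq
balanced-budget {a} {b} {p} {q} {dA} {dB} {dq} small refl budget = +-cancelˡ-≤ (a + a) _ _ (begin
  a + a + (q + 2)                ≡⟨ solve (a ∷ q ∷ []) ⟩
  a + a + q + 2                  ≤⟨ budget ⟩
  p + 2 * (dA + dB + dq)         ≡⟨ solve (p ∷ dA ∷ dB ∷ dq ∷ []) ⟩
  2 * (dA + dB) + (p + 2 * dq)   ≤⟨ +-monoˡ-≤ _ (*-monoʳ-≤ 2 small) ⟩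
  2 * a + (p + 2 * dq)           ≡⟨ solve (a ∷ p ∷ dq ∷ []) ⟩
  a + a + (p + 2 * dq)           ∎)
  where open ≤-Reasoning

drop-budgetˡ : ∀ {x y p q dx dy dq} → dx ≤ x →
               x + y + q + 2 ≤ p + 2 * (dx + dy + dq) → y + q + 2 ≤ p + x + 2 * (dy + dq)
drop-budgetˡ {x} {y} {p} {q} {dx} {dy} {dq} dx≤x budget = +-cancelˡ-≤ x _ _ (begin
  x + (y + q + 2)               ≡⟨ solve (x ∷ y ∷ q ∷ []) ⟩
  x + y + q + 2                 ≤⟨ budget ⟩
  p + 2 * (dx + dy + dq)        ≡⟨ solve (p ∷ dx ∷ dy ∷ dq ∷ []) ⟩
  2 * dx + (p + 2 * (dy + dq))  ≤⟨ +-monoˡ-≤ _ (*-monoʳ-≤ 2 dx≤x) ⟩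
  2 * x + (p + 2 * (dy + dq))   ≡⟨ solve (x ∷ p ∷ dy ∷ dq ∷ []) ⟩
  x + (p + x + 2 * (dy + dq))   ∎)
  where open ≤-Reasoning

drop-budgetʳ : ∀ {x y p q dx dy dq} → dy ≤ y →
               x + y + q + 2 ≤ p + 2 * (dx + dy + dq) → x + q + 2 ≤ p + y + 2 * (dx + dq)
drop-budgetʳ {x} {y} {p} {q} {dx} {dy} {dq} dy≤y budget = drop-budgetˡ {p = p} {dx = dy} {dx} {dq} dy≤y (begin
  y + x + q + 2           ≡⟨ solve (x ∷ y ∷ q ∷ []) ⟩
  x + y + q + 2           ≤⟨ budget ⟩
  p + 2 * (dx + dy + dq)  ≡⟨ solve (p ∷ dx ∷ dy ∷ dq ∷ []) ⟩
  p + 2 * (dy + dx + dq)  ∎)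
  where open ≤-Reasoning

unbalanced-budget : ∀ {a b s t dA dB dT} → dA ≤ a → a ≤ b → 2 * dB < b ∸ a → s ≤ t →
                    a + b + t + 2 ≤ s + 2 * (dA + dB + dT) → 2 ≤ dT
unbalanced-budget {a} {b} {s} {t} {dA} {dB} {dT} dA≤a a≤b dB-small s≤t budget =
  excess⇒2≤ {u = s + 2 * a + 2 * dB + 1} {v = s + 2 * a + 2 * dB} (begin
    s + 2 * a + 2 * dB + 1 + 2        ≡⟨ solve (s ∷ a ∷ dB ∷ []) ⟩
    a + (2 * dB + 1 + a) + s + 2      ≤⟨ +-monoˡ-≤ 2 (+-mono-≤ (+-monoʳ-≤ a b-large) s≤t) ⟩
    a + b + t + 2                     ≤⟨ budget ⟩
    s + 2 * (dA + dB + dT)            ≡⟨ solve (s ∷ dA ∷ dB ∷ dT ∷ []) ⟩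
    s + 2 * dA + 2 * dB + 2 * dT      ≤⟨ +-monoˡ-≤ _ (+-monoˡ-≤ _ (+-monoʳ-≤ s (*-monoʳ-≤ 2 dA≤a))) ⟩
    s + 2 * a + 2 * dB + 2 * dT       ∎) (m<m+n _ (s≤s z≤n))
  where
  open ≤-Reasoning
  b-large : 2 * dB + 1 + a ≤ b
  b-large = begin
    2 * dB + 1 + a   ≡⟨ cong (_+ a) (+-comm (2 * dB) 1) ⟩
    suc (2 * dB) + a ≤⟨ +-monoˡ-≤ a dB-small ⟩
    b ∸ a + a        ≡⟨ m∸n+n≡m a≤b ⟩
    b                ∎

b≤2*[b∸a] : ∀ {a b} → 2 * a ≤ b → b ≤ 2 * (b ∸ a)
b≤2*[b∸a] {a} {b} 2a≤b = +-cancelˡ-≤ (2 * a) _ _ (begin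
  2 * a + b                    ≤⟨ +-monoˡ-≤ b 2a≤b ⟩
  b + b                        ≡⟨ cong (λ m → m + m) (sym (m∸n+n≡m a≤b)) ⟩
  (b ∸ a + a) + (b ∸ a + a)    ≡⟨ rearrange (b ∸ a) a ⟩
  2 * a + 2 * (b ∸ a)          ∎)
  where
  open ≤-Reasoning
  a≤b : a ≤ b
  a≤b = ≤-trans (m≤m+n a (a + 0)) 2a≤b
  rearrange : ∀ x y → x + y + (x + y) ≡ 2 * y + 2 * x
  rearrange = solve-∀

at-least-three : ∀ {n h l} → 100 ≤ n → 100 * h ≤ 12 * n → 49 * n ≤ 100 * (h + l) + 50 → 3 ≤ l
at-least-three {n} {h} {l} n≥100 h-small large with 3 ≤? l
... | yes 3≤l = 3≤l
... | no  3≰l = contradiction (begin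
      37 * 100 + 12 * n          ≤⟨ +-monoˡ-≤ _ (*-monoʳ-≤ 37 n≥100) ⟩
      37 * n + 12 * n            ≡⟨ solve (n ∷ []) ⟩
      49 * n                     ≤⟨ large ⟩
      100 * (h + l) + 50         ≡⟨ solve (h ∷ l ∷ []) ⟩
      100 * h + 100 * l + 50     ≤⟨ +-monoˡ-≤ 50 (+-mono-≤ h-small (*-monoʳ-≤ 100 (s≤s⁻¹ (≰⇒> 3≰l)))) ⟩
      12 * n + 100 * 2 + 50      ≡⟨ solve (n ∷ []) ⟩
      250 + 12 * n               ∎) (<⇒≱ (+-monoˡ-< (12 * n) (m≤m+n 251 3449)))
      where open ≤-Reasoning

half-excess : ∀ {n h s} → n ≤ 2 * h + 1 → 100 * h ≤ 100 * s + n → 49 * n ≤ 100 * s + 50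
half-excess {n} {h} {s} n≤2h+1 h-bound = +-cancelʳ-≤ n _ _ (begin
  49 * n + n               ≡⟨ solve (n ∷ []) ⟩
  50 * n                   ≤⟨ *-monoʳ-≤ 50 n≤2h+1 ⟩
  50 * (2 * h + 1)         ≡⟨ solve (h ∷ []) ⟩
  100 * h + 50             ≤⟨ +-monoˡ-≤ 50 h-bound ⟩
  100 * s + n + 50         ≡⟨ solve (s ∷ n ∷ []) ⟩
  100 * s + 50 + n         ∎)
  where open ≤-Reasoning

2*n<1⇒n≡0 : ∀ {n} → 2 * n < 1 → n ≡ 0
2*n<1⇒n≡0 {zero} _ = refl
2*n<1⇒n≡0 {suc n} (s≤s ())

-- Parts and degrees

is⇒≡ : ∀ {p q} → is p q ≡ true → q ≡ p
is⇒≡ {PA} {PA} _ = refl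
is⇒≡ {PB} {PB} _ = refl
is⇒≡ {PS} {PS} _ = refl
is⇒≡ {PT} {PT} _ = refl
is⇒≡ {PA} {PB} ()
is⇒≡ {PA} {PS} ()
is⇒≡ {PA} {PT} ()
is⇒≡ {PB} {PA} ()
is⇒≡ {PB} {PS} ()
is⇒≡ {PB} {PT} ()
is⇒≡ {PS} {PA} ()
is⇒≡ {PS} {PB} ()
is⇒≡ {PS} {PT} ()
is⇒≡ {PT} {PA} ()
is⇒≡ {PT} {PB} ()
is⇒≡ {PT} {PS} ()

is-refl : ∀ p → is p p ≡ true
is-refl PA = refl
is-refl PB = refl
is-refl PS = refl
is-refl PT = refl

indicator-parts : ∀ b q → indicator b ≡ indicator (b ∧ is PA q) + indicator (b ∧ is PB q)
                                      + indicator (b ∧ is PS q) + indicator (b ∧ is PT q)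
indicator-parts false q  = refl
indicator-parts true  PA = refl
indicator-parts true  PB = refl
indicator-parts true  PS = refl
indicator-parts true  PT = refl

data Opposite : Part → Part → Set where
  S-T : Opposite PS PT
  T-S : Opposite PT PS

module _ {n : ℕ} (π : Fin n → Part) where

  members : Part → Fin n → Bool
  members p y = is p (π y)

  card : Part → ℕ
  card p = count (members p)

  degree : (Fin n → Fin n → Bool) → Part → Fin n → ℕ
  degree R p x = count (λ y → R x y ∧ members p y)

  size≡card : ∀ p → size π p ≡ card p
  size≡card p = ∣tabulate∣≡count (members p)

  count-parts : (f : Fin n → Bool) → count f ≡ count (λ y → f y ∧ is PA (π y)) + count (λ y → f y ∧ is PB (π y))
                                           + count (λ y → f y ∧ is PS (π y)) + count (λ y → f y ∧ is PT (π y))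
  count-parts f = begin
    count f                    ≡⟨ sum-cong-≗ (λ y → indicator-parts (f y) (π y)) ⟩
    sum (λ y → a y + b y + s y + t y) ≡⟨ ∑-distrib-+ (λ y → a y + b y + s y) t ⟩
    sum (λ y → a y + b y + s y) + sum t ≡⟨ cong (_+ sum t) (∑-distrib-+ (λ y → a y + b y) s) ⟩
    sum (λ y → a y + b y) + sum s + sum t ≡⟨ cong (λ z → z + sum s + sum t) (∑-distrib-+ a b) ⟩
    sum a + sum b + sum s + sum t ∎
    where
    open ≡-Reasoning
    in-part : Part → Fin n → ℕ
    in-part p y = indicator (f y ∧ is p (π y))
    a = in-part PA
    b = in-part PB
    s = in-part PS
    t = in-part PT

  card-total : n ≡ card PA + card PB + card PS + card PT
  card-total = trans (sym (count-true n)) (count-parts (λ _ → true))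

  degree≤card : ∀ R p x → degree R p x ≤ card p
  degree≤card R p x = count-mono λ y → ∧-conicalʳ (R x y) _

  degree<card : ∀ R p x → R x x ≡ false → π x ≡ p → degree R p x < card p
  degree<card R p x Rxx πx = count-< (λ y → ∧-conicalʳ (R x y) _) x (cong (_∧ is p (π x)) Rxx)
    (trans (cong (is p) πx) (is-refl p))

  degree-total : ∀ R x → count (R x) ≡ degree R PA x + degree R PB x + degree R PS x + degree R PT x
  degree-total R x = count-parts (R x)

  edge-indicator : (Fin n → Fin n → Bool) → Part → Part → Fin n → Fin n → ℕ
  edge-indicator R p q x y = indicator (is p (π x) ∧ (R x y ∧ is q (π y)))

  edges : (Fin n → Fin n → Bool) → Part → Part → ℕ
  edges R p q = sum λ x → sum (edge-indicator R p q x)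

  edges-flip : ∀ R p q → edges R p q ≡ edges (flip R) q p
  edges-flip R p q = trans (∑-comm (edge-indicator R p q)) (sum-cong-≗ λ y → sum-cong-≗ λ x →
    cong indicator (∧-rotate (is p (π x)) (R x y) (is q (π y))))
    where
    ∧-rotate : ∀ a b c → a ∧ (b ∧ c) ≡ c ∧ (b ∧ a)
    ∧-rotate a b c = trans (sym (∧-assoc a b c)) (trans (∧-comm (a ∧ b) c) (cong (c ∧_) (∧-comm a b)))

  heavy light : (Fin n → Fin n → Bool) → Part → Part → ℕ → Fin n → Bool
  heavy R p q k x = members p x ∧ (k ≤ᵇ 2 * degree R q x)
  light R p q k x = members p x ∧ not (k ≤ᵇ 2 * degree R q x)

  light⇒ : ∀ R p q k x → light R p q k x ≡ true → π x ≡ p × 2 * degree R q x < k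
  light⇒ R p q k x e with is p (π x) in πx | k ≤ᵇ 2 * degree R q x in k≤
  ... | true | false = is⇒≡ πx , ≰⇒> λ k≤d → subst T k≤ (≤⇒≤ᵇ k≤d)

  card≡heavy+light : ∀ R p q k → card p ≡ count (heavy R p q k) + count (light R p q k)
  card≡heavy+light R p q k = count-∧-not (members p) (λ x → k ≤ᵇ 2 * degree R q x)

  heavy-markov : ∀ R p q k → k * count (heavy R p q k) ≤ 2 * edges R p q
  heavy-markov R p q k = subst (k * count (heavy R p q k) ≤_) (sym (*-distribˡ-sum 2 (λ x → sum (edge-indicator R p q x))))
    (count-markov (heavy R p q k) (λ x → 2 * sum (edge-indicator R p q x)) k pointwise)
    where
    pointwise : ∀ x → heavy R p q k x ≡ true → k ≤ 2 * sum (edge-indicator R p q x)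
    pointwise x e with is p (π x)
    ... | true = ≤ᵇ⇒≤ k _ (subst T (sym e) _)

  edges-bound : ∀ R p q c C → (∀ y → π y ≡ q → c * degree (flip R) p y ≤ C) → c * edges (flip R) q p ≤ C * card q
  edges-bound R p q c C bound = sum≤count (members q) (λ y → sum (edge-indicator (flip R) q p y)) c C pointwise
    where
    pointwise : ∀ y → c * sum (edge-indicator (flip R) q p y) ≤ C * indicator (is q (π y))
    pointwise y with is q (π y) in πy
    ... | true  = ≤-trans (bound y (is⇒≡ πy)) (≤-reflexive (sym (*-identityʳ C)))
    ... | false = ≤-reflexive (trans (cong (c *_) (sum-replicate-zero n)) (trans (*-zeroʳ c) (sym (*-zeroʳ C))))

  degree-budget : ∀ {p q} → Opposite p q → ∀ R x → R x x ≡ false → π x ≡ p → n ≤ 2 * count (R x) →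
    card PA + card PB + card q + 2 ≤ card p + 2 * (degree R PA x + degree R PB x + degree R q x)
  degree-budget {p} {q} opp R x Rxx πx half =
    exclude-own-part {card PA} {card PB} {card p} {card q} {degree R PA x} {degree R PB x} {degree R p x} {degree R q x}
      (subst₂ (λ m d → m ≤ 2 * d) (sizes opp) (degrees opp) half) (degree<card R p x Rxx πx)
    where
    sizes : Opposite p q → n ≡ card PA + card PB + card p + card q
    sizes S-T = card-total
    sizes T-S = trans card-total (xy∙z≈xz∙y (card PA + card PB) (card PS) (card PT))
    degrees : Opposite p q → count (R x) ≡ degree R PA x + degree R PB x + degree R p x + degree R q x
    degrees S-T = degree-total R x
    degrees T-S = trans (degree-total R x) (xy∙z≈xz∙y (degree R PA x + degree R PB x) (degree R PS x) (degree R PT x))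

  -- Each heavy vertex of p sends at least k/2 edges to q, each vertex of q receives at most
  -- 3n/100 from p, and |q| ≤ 2k; hence at most 12n/100 vertices of p are heavy.
  light-many : ∀ R p q k → 1 ≤ k → card q ≤ 2 * k → (∀ y → π y ≡ q → 100 * degree (flip R) p y ≤ 3 * n) →
               100 ≤ n → 49 * n ≤ 100 * card p + 50 → 3 ≤ count (light R p q k)
  light-many R p q k k≥1 q≤2k sparse n≥100 p-large =
    at-least-three {h = h} {l = count (light R p q k)} n≥100 heavy-few
      (subst (λ c → 49 * n ≤ 100 * c + 50) (card≡heavy+light R p q k) p-large)
    where
    open ≤-Reasoning
    h = count (heavy R p q k)
    e = edges (flip R) q p
    heavy-few : 100 * h ≤ 12 * n
    heavy-few = *-cancelˡ-≤ k {{>-nonZero k≥1}} (begin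
      k * (100 * h)                ≡⟨ *-exchange k 100 h ⟩
      100 * (k * h)                ≤⟨ *-monoʳ-≤ 100 (heavy-markov R p q k) ⟩
      100 * (2 * edges R p q)      ≡⟨ cong (λ m → 100 * (2 * m)) (edges-flip R p q) ⟩
      100 * (2 * e)                ≡⟨ *-exchange 100 2 e ⟩
      2 * (100 * e)                ≤⟨ *-monoʳ-≤ 2 (edges-bound R p q 100 (3 * n) sparse) ⟩
      2 * (3 * n * card q)         ≤⟨ *-monoʳ-≤ 2 (*-monoʳ-≤ (3 * n) q≤2k) ⟩
      2 * (3 * n * (2 * k))        ≡⟨ solve (n ∷ k ∷ []) ⟩
      k * (12 * n)                 ∎)

-- Disjoint edges

module _ {n : ℕ} where

  Disjoint : (Fin n → Bool) → (Fin n → Bool) → Set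
  Disjoint X Y = ∀ v → X v ≡ true → Y v ≡ true → ⊥

  disjoint⇒≢ : ∀ {X Y x y} → Disjoint X Y → X x ≡ true → Y y ≡ true → x ≢ y
  disjoint⇒≢ X∩Y Xx Yy refl = X∩Y _ Xx Yy

  disjoint⇒≢′ : ∀ {X Y x y} → Disjoint X Y → Y x ≡ true → X y ≡ true → x ≢ y
  disjoint⇒≢′ X∩Y Yx Xy refl = X∩Y _ Xy Yx

  _∪_ : (Fin n → Bool) → (Fin n → Bool) → Fin n → Bool
  (X ∪ Y) v = X v ∨ Y v

  ∪-true : ∀ {X Y : Fin n → Bool} {v} → (X ∪ Y) v ≡ true → X v ≡ true ⊎ Y v ≡ true
  ∪-true {X} {Y} {v} e with X v
  ... | true  = inj₁ refl
  ... | false = inj₂ e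

  Disjoint-∪ʳ : ∀ {X Y Z} → Disjoint X Y → Disjoint X Z → Disjoint X (Y ∪ Z)
  Disjoint-∪ʳ {X} {Y} {Z} X∩Y X∩Z v Xv YZv = [ X∩Y v Xv , X∩Z v Xv ]′ (∪-true {Y} {Z} YZv)

  Disjoint-∪ˡ : ∀ {X Y Z} → Disjoint X Z → Disjoint Y Z → Disjoint (X ∪ Y) Z
  Disjoint-∪ˡ {X} {Y} {Z} X∩Z Y∩Z v XYv Zv = [ (λ Xv → X∩Z v Xv Zv) , (λ Yv → Y∩Z v Yv Zv) ]′ (∪-true {X} {Y} XYv)

  count-∪ : ∀ (f : Fin n → Bool) {Y Z} → Disjoint Y Z →
            count (λ v → f v ∧ (Y ∪ Z) v) ≡ count (λ v → f v ∧ Y v) + count (λ v → f v ∧ Z v)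
  count-∪ f {Y} {Z} Y∩Z =
    trans (sum-cong-≗ pointwise) (∑-distrib-+ (λ v → indicator (f v ∧ Y v)) (λ v → indicator (f v ∧ Z v)))
    where
    pointwise : ∀ v → indicator (f v ∧ (Y v ∨ Z v)) ≡ indicator (f v ∧ Y v) + indicator (f v ∧ Z v)
    pointwise v with f v | Y v in Yv | Z v in Zv
    ... | false | _     | _     = refl
    ... | true  | false | _     = refl
    ... | true  | true  | false = refl
    ... | true  | true  | true  = ⊥-elim (Y∩Z v Yv Zv)

  Arc : (Fin n → Bool) → (Fin n → Bool) → Fin n → Fin n → Set
  Arc X Y x y = X x ≡ true × Y y ≡ true

  neighbour : ∀ (R : Fin n → Fin n → Bool) (Y : Fin n → Bool) x → 1 ≤ count (λ y → R x y ∧ Y y) →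
              ∃[ y ] R x y ≡ true × Y y ≡ true
  neighbour R Y x h =
    let y , e = count-witness (λ y → R x y ∧ Y y) h in y , ∧-conicalˡ (R x y) (Y y) e , ∧-conicalʳ (R x y) (Y y) e

  neighbour-≢ : ∀ (R : Fin n → Fin n → Bool) (Y : Fin n → Bool) x → 2 ≤ count (λ y → R x y ∧ Y y) → ∀ w →
                ∃[ y ] R x y ≡ true × Y y ≡ true × y ≢ w
  neighbour-≢ R Y x h w =
    let y , e , y≢w = count-witness-≢ (λ y → R x y ∧ Y y) h w
    in y , ∧-conicalˡ (R x y) (Y y) e , ∧-conicalʳ (R x y) (Y y) e , y≢w


module _ {n : ℕ} (G : Digraph n) where

  TwoDisjointEdges-map : ∀ {P P′ Q Q′ : Fin n → Fin n → Set} →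
    (∀ {x y} → P x y → P′ x y) → (∀ {x y} → Q x y → Q′ x y) → TwoDisjointEdges G P Q → TwoDisjointEdges G P′ Q′
  TwoDisjointEdges-map f g (x , y , u , v , xy , uv , Pxy , Quv , disj) = x , y , u , v , xy , uv , f Pxy , g Quv , disj

  d⁺ d⁻ : (Fin n → Bool) → Fin n → ℕ
  d⁺ Y x = count (λ y → edge G x y ∧ Y y)
  d⁻ Y x = count (λ y → edge G y x ∧ Y y)

  module _ {X Y : Fin n → Bool} (X∩Y : Disjoint X Y)
           {x₁ x₂} (Xx₁ : X x₁ ≡ true) (Xx₂ : X x₂ ≡ true) (x₁≢x₂ : x₁ ≢ x₂) where

    two-out-edges : 1 ≤ d⁺ Y x₁ → 2 ≤ d⁺ Y x₂ → TwoDisjointEdges G (Arc X Y) (Arc X Y)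
    two-out-edges h₁ h₂ =
      let y₁ , e₁ , Yy₁ = neighbour (edge G) Y x₁ h₁
          y₂ , e₂ , Yy₂ , y₂≢y₁ = neighbour-≢ (edge G) Y x₂ h₂ y₁
      in x₁ , y₁ , x₂ , y₂ , e₁ , e₂ , (Xx₁ , Yy₁) , (Xx₂ , Yy₂) ,
         x₁≢x₂ , disjoint⇒≢ X∩Y Xx₁ Yy₂ , disjoint⇒≢′ X∩Y Yy₁ Xx₂ , y₂≢y₁ ∘ sym

    two-in-edges : 1 ≤ d⁻ Y x₁ → 2 ≤ d⁻ Y x₂ → TwoDisjointEdges G (Arc Y X) (Arc Y X)
    two-in-edges h₁ h₂ =
      let y₁ , e₁ , Yy₁ = neighbour (flip (edge G)) Y x₁ h₁
          y₂ , e₂ , Yy₂ , y₂≢y₁ = neighbour-≢ (flip (edge G)) Y x₂ h₂ y₁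
      in y₁ , x₁ , y₂ , x₂ , e₁ , e₂ , (Yy₁ , Xx₁) , (Yy₂ , Xx₂) ,
         y₂≢y₁ ∘ sym , disjoint⇒≢′ X∩Y Yy₁ Xx₂ , disjoint⇒≢ X∩Y Xx₁ Yy₂ , x₁≢x₂

    out-and-in-edge : 1 ≤ d⁺ Y x₁ → 2 ≤ d⁻ Y x₂ → TwoDisjointEdges G (Arc X Y) (Arc Y X)
    out-and-in-edge h₁ h₂ =
      let y₁ , e₁ , Yy₁ = neighbour (edge G) Y x₁ h₁
          y₂ , e₂ , Yy₂ , y₂≢y₁ = neighbour-≢ (flip (edge G)) Y x₂ h₂ y₁
      in x₁ , y₁ , y₂ , x₂ , e₁ , e₂ , (Xx₁ , Yy₁) , (Yy₂ , Xx₂) ,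
         disjoint⇒≢ X∩Y Xx₁ Yy₂ , x₁≢x₂ , y₂≢y₁ ∘ sym , disjoint⇒≢′ X∩Y Yy₁ Xx₂

  module _ {X Y : Fin n → Bool} (X∩Y : Disjoint X Y)
           {z z′} (Yz : Y z ≡ true) (Yz′ : Y z′ ≡ true) (z≢z′ : z ≢ z′) where

    -- If z and z′ share their in-neighbour y, an out-edge of another X-vertex x ≠ y settles it.
    two-edges-into-pair : 1 ≤ d⁻ X z → 1 ≤ d⁻ X z′ → (∀ w → ∃[ x ] X x ≡ true × x ≢ w × 1 ≤ d⁺ Y x) →
                          TwoDisjointEdges G (Arc X Y) (Arc X Y)
    two-edges-into-pair h h′ sources with neighbour (flip (edge G)) X z h | neighbour (flip (edge G)) X z′ h′
    ... | y , yz , Xy | y′ , y′z′ , Xy′ with y ≟ᶠ y′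
    ... | no y≢y′ = y , z , y′ , z′ , yz , y′z′ , (Xy , Yz) , (Xy′ , Yz′) ,
                    y≢y′ , disjoint⇒≢ X∩Y Xy Yz′ , disjoint⇒≢′ X∩Y Yz Xy′ , z≢z′
    ... | yes refl with sources y
    ... | x , Xx , x≢y , hx with neighbour (edge G) Y x hx
    ... | w , xw , Yw with w ≟ᶠ z
    ... | no w≢z = x , w , y , z , xw , yz , (Xx , Yw) , (Xy , Yz) ,
                   x≢y , disjoint⇒≢ X∩Y Xx Yz , disjoint⇒≢′ X∩Y Yw Xy , w≢z
    ... | yes refl = x , w , y , z′ , xw , y′z′ , (Xx , Yw) , (Xy , Yz′) ,
                     x≢y , disjoint⇒≢ X∩Y Xx Yz′ , disjoint⇒≢′ X∩Y Yw Xy , z≢z′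

    -- x avoids y and y′, so the reverse edge comes from whichever of z, z′ is not x's out-neighbour.
    edge-and-reverse-from-pair : 1 ≤ d⁺ X z → 1 ≤ d⁺ X z′ →
                                 (∀ w w′ → ∃[ x ] X x ≡ true × x ≢ w × x ≢ w′ × 1 ≤ d⁺ Y x) →
                                 TwoDisjointEdges G (Arc X Y) (Arc Y X)
    edge-and-reverse-from-pair h h′ sources with neighbour (edge G) X z h | neighbour (edge G) X z′ h′
    ... | y , zy , Xy | y′ , z′y′ , Xy′ with sources y y′
    ... | x , Xx , x≢y , x≢y′ , hx with neighbour (edge G) Y x hx
    ... | w , xw , Yw with w ≟ᶠ z
    ... | no w≢z = x , w , z , y , xw , zy , (Xx , Yw) , (Yz , Xy) ,
                   disjoint⇒≢ X∩Y Xx Yz , x≢y , w≢z , disjoint⇒≢′ X∩Y Yw Xy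
    ... | yes refl = x , w , z′ , y′ , xw , z′y′ , (Xx , Yw) , (Yz′ , Xy′) ,
                     disjoint⇒≢ X∩Y Xx Yz′ , x≢y′ , z≢z′ , disjoint⇒≢′ X∩Y Yw Xy′

  module _ {X₁ Y₁ X₂ Y₂ : Fin n → Bool}
           (X₁∩Y₁ : Disjoint X₁ Y₁) (X₁∩X₂ : Disjoint X₁ X₂) (Y₁∩Y₂ : Disjoint Y₁ Y₂) where

    two-edges-from-either-side : 2 ≤ count X₁ → 2 ≤ count X₂ →
      (∀ x → X₁ x ≡ true → 1 ≤ d⁺ Y₁ x) → (∀ x → X₂ x ≡ true → 1 ≤ d⁺ Y₂ x) →
      TwoDisjointEdges G (λ x y → Arc X₁ Y₁ x y ⊎ Arc X₂ Y₂ x y) (λ x y → Arc X₁ Y₁ x y ⊎ Arc X₂ Y₂ x y)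
    two-edges-from-either-side X₁≥2 X₂≥2 out₁ out₂
      with count-witness X₁ (≤-trans (s≤s z≤n) X₁≥2)
    ... | x₁ , X₁x₁ with neighbour (edge G) Y₁ x₁ (out₁ x₁ X₁x₁)
    ... | w₁ , x₁w₁ , Y₁w₁ with count-witness-≢ X₂ X₂≥2 w₁
    ... | z , X₂z , z≢w₁ with neighbour (edge G) Y₂ z (out₂ z X₂z)
    ... | u , zu , Y₂u with u ≟ᶠ x₁
    ... | no u≢x₁ = x₁ , w₁ , z , u , x₁w₁ , zu , inj₁ (X₁x₁ , Y₁w₁) , inj₂ (X₂z , Y₂u) ,
                    disjoint⇒≢ X₁∩X₂ X₁x₁ X₂z , u≢x₁ ∘ sym , z≢w₁ ∘ sym ,
                    disjoint⇒≢ Y₁∩Y₂ Y₁w₁ Y₂u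
    ... | yes refl with count-witness-≢ X₁ X₁≥2 x₁
    ... | x₂ , X₁x₂ , x₂≢x₁ with neighbour (edge G) Y₁ x₂ (out₁ x₂ X₁x₂)
    ... | w₂ , x₂w₂ , Y₁w₂ with w₂ ≟ᶠ z
    ... | no w₂≢z = x₂ , w₂ , z , x₁ , x₂w₂ , zu , inj₁ (X₁x₂ , Y₁w₂) , inj₂ (X₂z , Y₂u) ,
                    disjoint⇒≢ X₁∩X₂ X₁x₂ X₂z , x₂≢x₁ , w₂≢z , disjoint⇒≢′ X₁∩Y₁ Y₁w₂ X₁x₁
    ... | yes refl = x₂ , w₂ , x₁ , w₁ , x₂w₂ , x₁w₁ , inj₁ (X₁x₂ , Y₁w₂) , inj₁ (X₁x₁ , Y₁w₁) ,
                     x₂≢x₁ , disjoint⇒≢ X₁∩Y₁ X₁x₂ Y₁w₁ , disjoint⇒≢′ X₁∩X₂ X₂z X₁x₁ , z≢w₁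

-- From the rational hypotheses to natural numbers

module Rationals where

  open import Data.Nat as ℕ using (ℕ)
  import Data.Nat.Properties as ℕ
  open import Data.Nat.DivMod using (m≡m%n+[m/n]*n; m%n<n)
  open import Data.Integer as ℤ using (+_)
  import Data.Integer.Properties as ℤ
  open import Data.Rational as ℚ using (ℚ; ½; 1ℚ; toℚᵘ)
  import Data.Rational.Properties as ℚ
  open import Data.Rational.Unnormalised as ℚᵘ using (ℚᵘ; mkℚᵘ; *≡*; *≤*)
  import Data.Rational.Unnormalised.Properties as ℚᵘ
  open import Data.Rational.Solver using (module +-*-Solver)
  open +-*-Solver using (_:=_; _:+_; _:*_; _:-_; con) renaming (solve to ℚ-solve)

  -- ⟦ n ⟧ = + n / 1 is stuck on a gcd, so its arithmetic is transported through ℚᵘ, where it is n / 1.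
  private
    embed : ℕ → ℚᵘ
    embed n = mkℚᵘ (+ n) 0

    toℚᵘ-⟦⟧ : ∀ n → toℚᵘ ⟦ n ⟧ ℚᵘ.≃ embed n
    toℚᵘ-⟦⟧ n = ℚ.toℚᵘ-fromℚᵘ (embed n)

  ⟦⟧-+ : ∀ m n → ⟦ m ℕ.+ n ⟧ ≡ ⟦ m ⟧ ℚ.+ ⟦ n ⟧
  ⟦⟧-+ m n = ℚ.toℚᵘ-injective (ℚᵘ.≃-trans (toℚᵘ-⟦⟧ (m ℕ.+ n)) (ℚᵘ.≃-sym
    (ℚᵘ.≃-trans (ℚ.toℚᵘ-homo-+ ⟦ m ⟧ ⟦ n ⟧) (ℚᵘ.≃-trans (ℚᵘ.+-cong (toℚᵘ-⟦⟧ m) (toℚᵘ-⟦⟧ n))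
      (*≡* (cong (ℤ._* + 1) (trans (cong₂ ℤ._+_ (ℤ.*-identityʳ (+ m)) (ℤ.*-identityʳ (+ n))) (sym (ℤ.pos-+ m n)))))))))

  ⟦⟧-* : ∀ m n → ⟦ m ℕ.* n ⟧ ≡ ⟦ m ⟧ ℚ.* ⟦ n ⟧
  ⟦⟧-* m n = ℚ.toℚᵘ-injective (ℚᵘ.≃-trans (toℚᵘ-⟦⟧ (m ℕ.* n)) (ℚᵘ.≃-sym
    (ℚᵘ.≃-trans (ℚ.toℚᵘ-homo-* ⟦ m ⟧ ⟦ n ⟧) (ℚᵘ.≃-trans (ℚᵘ.*-cong (toℚᵘ-⟦⟧ m) (toℚᵘ-⟦⟧ n))
      (*≡* (cong (ℤ._* + 1) (sym (ℤ.pos-* m n))))))))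

  ⟦⟧-cancel-≤ : ∀ {m n} → ⟦ m ⟧ ℚ.≤ ⟦ n ⟧ → m ℕ.≤ n
  ⟦⟧-cancel-≤ {m} {n} h
    with ℚᵘ.≤-respʳ-≃ (toℚᵘ-⟦⟧ n) (ℚᵘ.≤-respˡ-≃ (toℚᵘ-⟦⟧ m) (ℚ.toℚᵘ-mono-≤ h))
  ... | *≤* p = ℤ.drop‿+≤+ (subst₂ ℤ._≤_ (ℤ.*-identityʳ (+ m)) (ℤ.*-identityʳ (+ n)) p)

  private
    ⟦⟧-nonNeg : ∀ n → ℚ.NonNegative ⟦ n ⟧
    ⟦⟧-nonNeg n = ℚ.normalize-nonNeg n 1

    scale-cancel : ∀ c {m k} {p q} → p ℚ.≤ q → ⟦ c ⟧ ℚ.* p ≡ ⟦ m ⟧ → ⟦ c ⟧ ℚ.* q ≡ ⟦ k ⟧ → m ℕ.≤ k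
    scale-cancel c p≤q cp cq =
      ⟦⟧-cancel-≤ (subst₂ ℚ._≤_ cp cq (ℚ.*-monoˡ-≤-nonNeg ⟦ c ⟧ {{⟦⟧-nonNeg c}} p≤q))

    scale-≤ : ∀ {ε δ} n → ε ℚ.≤ δ → ε ℚ.* ⟦ n ⟧ ℚ.≤ δ ℚ.* ⟦ n ⟧
    scale-≤ n = ℚ.*-monoʳ-≤-nonNeg ⟦ n ⟧ {{⟦⟧-nonNeg n}}

  n≤2*[n/2]+1 : ∀ n → n ℕ.≤ 2 ℕ.* (n ℕ./ 2) ℕ.+ 1
  n≤2*[n/2]+1 n = begin
    n                           ≡⟨ m≡m%n+[m/n]*n n 2 ⟩
    n ℕ.% 2 ℕ.+ n ℕ./ 2 ℕ.* 2   ≤⟨ ℕ.+-monoˡ-≤ _ (ℕ.s≤s⁻¹ (m%n<n n 2)) ⟩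
    1 ℕ.+ n ℕ./ 2 ℕ.* 2         ≡⟨ ℕ.+-comm 1 _ ⟩
    n ℕ./ 2 ℕ.* 2 ℕ.+ 1         ≡⟨ cong (ℕ._+ 1) (ℕ.*-comm (n ℕ./ 2) 2) ⟩
    2 ℕ.* (n ℕ./ 2) ℕ.+ 1       ∎
    where open ℕ.≤-Reasoning

  hundredth : ℚ
  hundredth = + 1 ℚ./ 100

  half≤⇒≤2* : ∀ n d → ⟦ n ⟧ ℚ.* ½ ℚ.≤ ⟦ d ⟧ → n ℕ.≤ 2 ℕ.* d
  half≤⇒≤2* n d h =
    scale-cancel 2 h (ℚ-solve 1 (λ x → con ⟦ 2 ⟧ :* (x :* con ½) := x) refl ⟦ n ⟧) (sym (⟦⟧-* 2 d))

  ε*n≥1⇒n≥100 : ∀ {ε} n → ε ℚ.≤ hundredth → 1ℚ ℚ.≤ ε ℚ.* ⟦ n ⟧ → 100 ℕ.≤ n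
  ε*n≥1⇒n≥100 n ε≤ h = scale-cancel 100 (ℚ.≤-trans h (scale-≤ n ε≤))
    refl (ℚ-solve 1 (λ x → con ⟦ 100 ⟧ :* (con hundredth :* x) := x) refl ⟦ n ⟧)

  sparse⇒100*≤3*n : ∀ {η} n d → η ℚ.≤ hundredth → ⟦ d ⟧ ℚ.≤ ⟦ 3 ⟧ ℚ.* η ℚ.* ⟦ n ⟧ →
                    100 ℕ.* d ℕ.≤ 3 ℕ.* n
  sparse⇒100*≤3*n n d η≤ h = scale-cancel 100
    (ℚ.≤-trans h (scale-≤ n (ℚ.*-monoˡ-≤-nonNeg ⟦ 3 ⟧ {{⟦⟧-nonNeg 3}} η≤)))
    (sym (⟦⟧-* 100 d))
    (trans (ℚ-solve 1 (λ x → con ⟦ 100 ⟧ :* (con ⟦ 3 ⟧ :* con hundredth :* x) := con ⟦ 3 ⟧ :* x) refl ⟦ n ⟧)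
           (sym (⟦⟧-* 3 n)))

  near-half⇒49*n≤ : ∀ {ε} n s → ε ℚ.≤ hundredth → ⟦ n ℕ./ 2 ⟧ ℚ.- ε ℚ.* ⟦ n ⟧ ℚ.≤ ⟦ s ⟧ →
                    49 ℕ.* n ℕ.≤ 100 ℕ.* s ℕ.+ 50
  near-half⇒49*n≤ {ε} n s ε≤ h = half-excess {h = n ℕ./ 2} {s} (n≤2*[n/2]+1 n) half-bound
    where
    h′ = ⟦ n ℕ./ 2 ⟧
    half-bound : 100 ℕ.* (n ℕ./ 2) ℕ.≤ 100 ℕ.* s ℕ.+ n
    half-bound = scale-cancel 100 {p = h′} {q = ⟦ s ⟧ ℚ.+ hundredth ℚ.* ⟦ n ⟧}
      (subst (ℚ._≤ ⟦ s ⟧ ℚ.+ hundredth ℚ.* ⟦ n ⟧)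
             (ℚ-solve 3 (λ x y z → x :- y :* z :+ y :* z := x) refl h′ ε ⟦ n ⟧)
             (ℚ.+-mono-≤ h (scale-≤ n ε≤)))
      (sym (⟦⟧-* 100 (n ℕ./ 2)))
      (trans (ℚ-solve 2 (λ x y → con ⟦ 100 ⟧ :* (x :+ con hundredth :* y) := con ⟦ 100 ⟧ :* x :+ y) refl ⟦ s ⟧ ⟦ n ⟧)
             (sym (trans (⟦⟧-+ (100 ℕ.* s) n) (cong (ℚ._+ ⟦ n ⟧) (⟦⟧-* 100 s)))))

open Rationals

-- Only these consequences of (P1)–(P8) are used.
record Conditions {n : ℕ} (G : Digraph n) (π : Fin n → Part) : Set where
  field
    n≥100    : 100 ≤ n
    S-large  : 49 * n ≤ 100 * card π PS + 50
    S≤T      : card π PS ≤ card π PT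
    A≤B      : card π PA ≤ card π PB
    out-half : ∀ x → n ≤ 2 * count (edge G x)
    in-half  : ∀ x → n ≤ 2 * count (flip (edge G) x)
    A-sparse : ∀ x → π x ≡ PA → 100 * degree π (flip (edge G)) PS x ≤ 3 * n × 100 * degree π (edge G) PT x ≤ 3 * n
    B-sparse : ∀ x → π x ≡ PB → 100 * degree π (edge G) PS x ≤ 3 * n × 100 * degree π (flip (edge G)) PT x ≤ 3 * n

CrossEdge : ∀ {n} → (Fin n → Part) → Fin n → Fin n → Set
CrossEdge π x y = Between π PS PT x y ⊎ Between π PS PA x y ⊎ Between π PT PS x y ⊎ Between π PT PB x y

data Direction : Set where
  Out In : Direction

module _ {n : ℕ} {G : Digraph n} {π : Fin n → Part} (conditions : Conditions G π) where

  open Conditions conditions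

  a b s t : ℕ
  a = card π PA
  b = card π PB
  s = card π PS
  t = card π PT

  ⟨_⟩ : Part → Fin n → Bool
  ⟨_⟩ = members π

  arcs : Direction → Fin n → Fin n → Bool
  arcs Out = edge G
  arcs In  = flip (edge G)

  arcs-irrefl : ∀ dir x → arcs dir x x ≡ false
  arcs-irrefl Out = noLoop G
  arcs-irrefl In  = noLoop G

  arcs-half : ∀ dir x → n ≤ 2 * count (arcs dir x)
  arcs-half Out = out-half
  arcs-half In  = in-half

  budget : ∀ dir {p q} → Opposite p q → ∀ x → π x ≡ p →
    a + b + card π q + 2 ≤ card π p + 2 * (degree π (arcs dir) PA x + degree π (arcs dir) PB x + degree π (arcs dir) q x)
  budget dir opp x πx = degree-budget π opp (arcs dir) x (arcs-irrefl dir x) πx (arcs-half dir x)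

  T-large : 49 * n ≤ 100 * t + 50
  T-large = ≤-trans S-large (+-monoˡ-≤ 50 (*-monoʳ-≤ 100 S≤T))

  three≤card : ∀ {p} → 49 * n ≤ 100 * card π p + 50 → 3 ≤ card π p
  three≤card {p} = at-least-three {h = 0} {l = card π p} n≥100 z≤n

  S≥2 : 2 ≤ s
  S≥2 = ≤-trans (n≤1+n 2) (three≤card S-large)

  T≥2 : 2 ≤ t
  T≥2 = ≤-trans (n≤1+n 2) (three≤card T-large)

  member : ∀ {p x} → π x ≡ p → ⟨ p ⟩ x ≡ true
  member {p} πx = trans (cong (is p) πx) (is-refl p)

  ⟨⟩-disjoint : ∀ p q → p ≢ q → Disjoint ⟨ p ⟩ ⟨ q ⟩
  ⟨⟩-disjoint p q p≢q v pv qv = p≢q (trans (sym (is⇒≡ pv)) (is⇒≡ qv))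

  S∩T : Disjoint ⟨ PS ⟩ ⟨ PT ⟩
  S∩T = ⟨⟩-disjoint PS PT λ ()

  T∩S : Disjoint ⟨ PT ⟩ ⟨ PS ⟩
  T∩S = ⟨⟩-disjoint PT PS λ ()

  TwoBetween : Part → Part → Part → Part → Set
  TwoBetween p q p′ q′ = TwoDisjointEdges G (Between π p q) (Between π p′ q′)

  between : ∀ {p q p′ q′} → TwoDisjointEdges G (Arc ⟨ p ⟩ ⟨ q ⟩) (Arc ⟨ p′ ⟩ ⟨ q′ ⟩) →
            TwoBetween p q p′ q′
  between {p} {q} {p′} {q′} = TwoDisjointEdges-map G (arc⇒between {p} {q}) (arc⇒between {p′} {q′})
    where
    arc⇒between : ∀ {p q x y} → Arc ⟨ p ⟩ ⟨ q ⟩ x y → Between π p q x y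
    arc⇒between (px , qy) = is⇒≡ px , is⇒≡ qy

  -- Part (iv): if a + t < s + b every vertex of T has two out-neighbours in B ∪ S, if a + t > s + b
  -- every vertex of S has two in A ∪ T, and on a tie each of them has one.

  A∪T B∪S : Fin n → Bool
  A∪T = ⟨ PA ⟩ ∪ ⟨ PT ⟩
  B∪S = ⟨ PB ⟩ ∪ ⟨ PS ⟩

  S-excess : ∀ x → π x ≡ PS → a + t + 2 ≤ s + b + 2 * d⁺ G A∪T x
  S-excess x πx = subst (λ d → a + t + 2 ≤ s + b + 2 * d) (sym (count-∪ (edge G x) (⟨⟩-disjoint PA PT λ ())))
    (drop-budgetʳ {a} {b} {s} {t} {degree π (edge G) PA x} {degree π (edge G) PB x} {degree π (edge G) PT x}
       (degree≤card π (edge G) PB x) (budget Out S-T x πx))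

  T-excess : ∀ x → π x ≡ PT → b + s + 2 ≤ t + a + 2 * d⁺ G B∪S x
  T-excess x πx = subst (λ d → b + s + 2 ≤ t + a + 2 * d) (sym (count-∪ (edge G x) (⟨⟩-disjoint PB PS λ ())))
    (drop-budgetˡ {a} {b} {t} {s} {degree π (edge G) PA x} {degree π (edge G) PB x} {degree π (edge G) PS x}
       (degree≤card π (edge G) PA x) (budget Out T-S x πx))

  S∩A∪T : Disjoint ⟨ PS ⟩ A∪T
  S∩A∪T = Disjoint-∪ʳ (⟨⟩-disjoint PS PA λ ()) S∩T

  T∩B∪S : Disjoint ⟨ PT ⟩ B∪S
  T∩B∪S = Disjoint-∪ʳ (⟨⟩-disjoint PT PB λ ()) T∩S

  A∪T∩B∪S : Disjoint A∪T B∪S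
  A∪T∩B∪S = Disjoint-∪ˡ (Disjoint-∪ʳ (⟨⟩-disjoint PA PB λ ()) (⟨⟩-disjoint PA PS λ ()))
                        (Disjoint-∪ʳ (⟨⟩-disjoint PT PB λ ()) T∩S)

  SideEdge : Fin n → Fin n → Set
  SideEdge x y = Arc ⟨ PS ⟩ A∪T x y ⊎ Arc ⟨ PT ⟩ B∪S x y

  SideEdge⇒CrossEdge : ∀ {x y} → SideEdge x y → CrossEdge π x y
  SideEdge⇒CrossEdge (inj₁ (Sx , A∪Ty)) with ∪-true {X = ⟨ PA ⟩} {⟨ PT ⟩} A∪Ty
  ... | inj₁ Ay = inj₂ (inj₁ (is⇒≡ Sx , is⇒≡ Ay))
  ... | inj₂ Ty = inj₁ (is⇒≡ Sx , is⇒≡ Ty)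
  SideEdge⇒CrossEdge (inj₂ (Tx , B∪Sy)) with ∪-true {X = ⟨ PB ⟩} {⟨ PS ⟩} B∪Sy
  ... | inj₁ By = inj₂ (inj₂ (inj₂ (is⇒≡ Tx , is⇒≡ By)))
  ... | inj₂ Sy = inj₂ (inj₂ (inj₁ (is⇒≡ Tx , is⇒≡ Sy)))

  two-side-edges : TwoDisjointEdges G SideEdge SideEdge
  two-side-edges with <-cmp (a + t) (s + b)
  ... | tri< a+t<s+b _ _ =
    let z₁ , z₂ , Tz₁ , Tz₂ , z₁≢z₂ = count-witness₂ ⟨ PT ⟩ T≥2
        two : ∀ z → ⟨ PT ⟩ z ≡ true → 2 ≤ d⁺ G B∪S z
        two z Tz = excess⇒2≤ (T-excess z (is⇒≡ Tz)) (subst₂ _<_ (+-comm a t) (+-comm s b) a+t<s+b)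
    in TwoDisjointEdges-map G inj₂ inj₂
         (two-out-edges G T∩B∪S Tz₁ Tz₂ z₁≢z₂ (≤-trans (s≤s z≤n) (two z₁ Tz₁)) (two z₂ Tz₂))
  ... | tri≈ _ a+t≡s+b _ =
    two-edges-from-either-side G S∩A∪T S∩T A∪T∩B∪S S≥2 T≥2
      (λ x Sx → excess⇒1≤ (S-excess x (is⇒≡ Sx)) (≤-reflexive (sym a+t≡s+b)))
      (λ z Tz → excess⇒1≤ (T-excess z (is⇒≡ Tz)) (≤-reflexive (trans (+-comm t a) (trans a+t≡s+b (+-comm s b)))))
  ... | tri> _ _ s+b<a+t =
    let x₁ , x₂ , Sx₁ , Sx₂ , x₁≢x₂ = count-witness₂ ⟨ PS ⟩ S≥2
        two : ∀ x → ⟨ PS ⟩ x ≡ true → 2 ≤ d⁺ G A∪T x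
        two x Sx = excess⇒2≤ (S-excess x (is⇒≡ Sx)) s+b<a+t
    in TwoDisjointEdges-map G inj₁ inj₁
         (two-out-edges G S∩A∪T Sx₁ Sx₂ x₁≢x₂ (≤-trans (s≤s z≤n) (two x₁ Sx₁)) (two x₂ Sx₂))

  part-iv : TwoDisjointEdges G (CrossEdge π) (CrossEdge π)
  part-iv = TwoDisjointEdges-map G SideEdge⇒CrossEdge SideEdge⇒CrossEdge two-side-edges

  -- Part (i): with k = 1, a light vertex has no neighbour at all in A (or in B), and a = b then
  -- makes its budget read  (other half) + 2 ≤ (own half) + 2 · (degree into the other half).

  light-excess : a ≡ b → ∀ dir {p q} → Opposite p q → ∀ X → X ≡ PA ⊎ X ≡ PB → ∀ x →
    light π (arcs dir) p X 1 x ≡ true → ⟨ p ⟩ x ≡ true × card π q + 2 ≤ card π p + 2 * degree π (arcs dir) q x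
  light-excess a≡b dir {p} {q} opp X X∈AB x e =
    let πx , 2d<1 = light⇒ π (arcs dir) p X 1 x e
    in member πx , balanced-budget {a} {b} {card π p} {card π q} {d PA} {d PB} {d q}
                     (small X∈AB (2*n<1⇒n≡0 2d<1)) a≡b (budget dir opp x πx)
    where
    d : Part → ℕ
    d r = degree π (arcs dir) r x
    small : X ≡ PA ⊎ X ≡ PB → d X ≡ 0 → d PA + d PB ≤ a
    small (inj₁ refl) dA≡0 rewrite dA≡0 = subst (d PB ≤_) (sym a≡b) (degree≤card π (arcs dir) PB x)
    small (inj₂ refl) dB≡0 rewrite dB≡0 = subst (_≤ a) (sym (+-identityʳ (d PA))) (degree≤card π (arcs dir) PA x)

  module EqualAB (a≡b : a ≡ b) (a≤1 : a ≤ 1) where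

    A≤2 : a ≤ 2 * 1
    A≤2 = ≤-trans a≤1 (s≤s z≤n)

    B≤2 : b ≤ 2 * 1
    B≤2 = subst (_≤ 2 * 1) a≡b A≤2

    S⁺ S⁻ T⁺ T⁻ : Fin n → Bool
    S⁺ = light π (edge G) PS PA 1
    S⁻ = light π (flip (edge G)) PS PB 1
    T⁺ = light π (edge G) PT PB 1
    T⁻ = light π (flip (edge G)) PT PA 1

    many-S⁺ : 3 ≤ count S⁺
    many-S⁺ = light-many π (edge G) PS PA 1 (s≤s z≤n) A≤2 (λ y πy → proj₁ (A-sparse y πy)) n≥100 S-large

    many-S⁻ : 3 ≤ count S⁻
    many-S⁻ = light-many π (flip (edge G)) PS PB 1 (s≤s z≤n) B≤2 (λ y πy → proj₁ (B-sparse y πy)) n≥100 S-large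

    many-T⁺ : 3 ≤ count T⁺
    many-T⁺ = light-many π (edge G) PT PB 1 (s≤s z≤n) B≤2 (λ y πy → proj₂ (B-sparse y πy)) n≥100 T-large

    many-T⁻ : 3 ≤ count T⁻
    many-T⁻ = light-many π (flip (edge G)) PT PA 1 (s≤s z≤n) A≤2 (λ y πy → proj₂ (A-sparse y πy)) n≥100 T-large

    S⁺-excess : ∀ x → S⁺ x ≡ true → ⟨ PS ⟩ x ≡ true × t + 2 ≤ s + 2 * d⁺ G ⟨ PT ⟩ x
    S⁺-excess = light-excess a≡b Out S-T PA (inj₁ refl)

    S⁻-excess : ∀ x → S⁻ x ≡ true → ⟨ PS ⟩ x ≡ true × t + 2 ≤ s + 2 * d⁻ G ⟨ PT ⟩ x
    S⁻-excess = light-excess a≡b In S-T PB (inj₂ refl)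

    T⁺-excess : ∀ x → T⁺ x ≡ true → ⟨ PT ⟩ x ≡ true × s + 2 ≤ t + 2 * d⁺ G ⟨ PS ⟩ x
    T⁺-excess = light-excess a≡b Out T-S PB (inj₂ refl)

    T⁻-excess : ∀ x → T⁻ x ≡ true → ⟨ PT ⟩ x ≡ true × s + 2 ≤ t + 2 * d⁻ G ⟨ PS ⟩ x
    T⁻-excess = light-excess a≡b In T-S PA (inj₁ refl)

    module Strict (s<t : s < t) where

      two : ∀ {d} → t + 2 ≤ s + 2 * d → 2 ≤ d
      two h = excess⇒2≤ h s<t

      ST-ST : TwoBetween PS PT PS PT
      ST-ST = let x₁ , x₂ , e₁ , e₂ , x₁≢x₂ = count-witness₂ S⁺ (≤-trans (n≤1+n 2) many-S⁺)
                  Sx₁ , h₁ = S⁺-excess x₁ e₁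
                  Sx₂ , h₂ = S⁺-excess x₂ e₂
              in between (two-out-edges G S∩T Sx₁ Sx₂ x₁≢x₂ (≤-trans (s≤s z≤n) (two h₁)) (two h₂))

      TS-TS : TwoBetween PT PS PT PS
      TS-TS = let x₁ , x₂ , e₁ , e₂ , x₁≢x₂ = count-witness₂ S⁻ (≤-trans (n≤1+n 2) many-S⁻)
                  Sx₁ , h₁ = S⁻-excess x₁ e₁
                  Sx₂ , h₂ = S⁻-excess x₂ e₂
              in between (two-in-edges G S∩T Sx₁ Sx₂ x₁≢x₂ (≤-trans (s≤s z≤n) (two h₁)) (two h₂))

      ST-TS : TwoBetween PS PT PT PS
      ST-TS = let x₁ , e₁ = count-witness S⁺ (≤-trans (s≤s z≤n) many-S⁺)
                  x₂ , e₂ , x₂≢x₁ = count-witness-≢ S⁻ (≤-trans (n≤1+n 2) many-S⁻) x₁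
                  Sx₁ , h₁ = S⁺-excess x₁ e₁
                  Sx₂ , h₂ = S⁻-excess x₂ e₂
              in between (out-and-in-edge G S∩T Sx₁ Sx₂ (x₂≢x₁ ∘ sym) (≤-trans (s≤s z≤n) (two h₁)) (two h₂))

    module Balanced (s≡t : s ≡ t) where

      one-S : ∀ {d} → t + 2 ≤ s + 2 * d → 1 ≤ d
      one-S h = excess⇒1≤ h S≤T

      one-T : ∀ {d} → s + 2 ≤ t + 2 * d → 1 ≤ d
      one-T h = excess⇒1≤ h (≤-reflexive (sym s≡t))

      S⁺-avoiding : ∀ w → ∃[ x ] ⟨ PS ⟩ x ≡ true × x ≢ w × 1 ≤ d⁺ G ⟨ PT ⟩ x
      S⁺-avoiding w = let x , e , x≢w = count-witness-≢ S⁺ (≤-trans (n≤1+n 2) many-S⁺) w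
                          Sx , h = S⁺-excess x e
                      in x , Sx , x≢w , one-S h

      S⁺-avoiding₂ : ∀ w w′ → ∃[ x ] ⟨ PS ⟩ x ≡ true × x ≢ w × x ≢ w′ × 1 ≤ d⁺ G ⟨ PT ⟩ x
      S⁺-avoiding₂ w w′ = let x , e , x≢w , x≢w′ = count-witness-≢₂ S⁺ many-S⁺ w w′
                              Sx , h = S⁺-excess x e
                          in x , Sx , x≢w , x≢w′ , one-S h

      T⁺-avoiding : ∀ w → ∃[ x ] ⟨ PT ⟩ x ≡ true × x ≢ w × 1 ≤ d⁺ G ⟨ PS ⟩ x
      T⁺-avoiding w = let x , e , x≢w = count-witness-≢ T⁺ (≤-trans (n≤1+n 2) many-T⁺) w
                          Tx , h = T⁺-excess x e
                      in x , Tx , x≢w , one-T h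

      ST-ST : TwoBetween PS PT PS PT
      ST-ST = let z , z′ , e , e′ , z≢z′ = count-witness₂ T⁻ (≤-trans (n≤1+n 2) many-T⁻)
                  Tz , h = T⁻-excess z e
                  Tz′ , h′ = T⁻-excess z′ e′
              in between (two-edges-into-pair G S∩T Tz Tz′ z≢z′ (one-T h) (one-T h′) S⁺-avoiding)

      TS-TS : TwoBetween PT PS PT PS
      TS-TS = let z , z′ , e , e′ , z≢z′ = count-witness₂ S⁻ (≤-trans (n≤1+n 2) many-S⁻)
                  Sz , h = S⁻-excess z e
                  Sz′ , h′ = S⁻-excess z′ e′
              in between (two-edges-into-pair G T∩S Sz Sz′ z≢z′ (one-S h) (one-S h′) T⁺-avoiding)

      ST-TS : TwoBetween PS PT PT PS
      ST-TS = let z , z′ , e , e′ , z≢z′ = count-witness₂ T⁺ (≤-trans (n≤1+n 2) many-T⁺)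
                  Tz , h = T⁺-excess z e
                  Tz′ , h′ = T⁺-excess z′ e′
              in between (edge-and-reverse-from-pair G S∩T Tz Tz′ z≢z′ (one-T h) (one-T h′) S⁺-avoiding₂)

    all-directions : TwoBetween PS PT PS PT × TwoBetween PT PS PT PS × TwoBetween PS PT PT PS
    all-directions with m≤n⇒m<n∨m≡n S≤T
    ... | inj₁ s<t = let open Strict s<t in ST-ST , TS-TS , ST-TS
    ... | inj₂ s≡t = let open Balanced s≡t in ST-ST , TS-TS , ST-TS

  part-i : size π PA ≡ size π PB → size π PA ≡ 0 ⊎ size π PA ≡ 1 →
           TwoBetween PS PT PS PT × TwoBetween PT PS PT PS × TwoBetween PS PT PT PS
  part-i A≡B A≤1 = EqualAB.all-directions
    (trans (sym (size≡card π PA)) (trans A≡B (size≡card π PB)))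
    (subst (_≤ 1) (size≡card π PA) ([ (λ A≡0 → ≤-trans (≤-reflexive A≡0) z≤n) , ≤-reflexive ]′ A≤1))

  -- Parts (ii) and (iii): for k = b ∸ a the light vertices of S have fewer than k/2 in-neighbours
  -- in B, and then their budget forces two in-neighbours in T.

  TS-edges : a < b → 2 * a ≤ b → TwoBetween PT PS PT PS
  TS-edges a<b 2a≤b =
    let x₁ , x₂ , e₁ , e₂ , x₁≢x₂ = count-witness₂ L (≤-trans (n≤1+n 2) many-L)
        Sx₁ , h₁ = two-from-T x₁ e₁
        Sx₂ , h₂ = two-from-T x₂ e₂
    in between (two-in-edges G S∩T Sx₁ Sx₂ x₁≢x₂ (≤-trans (s≤s z≤n) h₁) h₂)
    where
    L : Fin n → Bool
    L = light π (flip (edge G)) PS PB (b ∸ a)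
    many-L : 3 ≤ count L
    many-L = light-many π (flip (edge G)) PS PB (b ∸ a) (m<n⇒0<n∸m a<b) (b≤2*[b∸a] {a} 2a≤b)
               (λ y πy → proj₁ (B-sparse y πy)) n≥100 S-large
    two-from-T : ∀ x → L x ≡ true → ⟨ PS ⟩ x ≡ true × 2 ≤ d⁻ G ⟨ PT ⟩ x
    two-from-T x e =
      let πx , 2d<k = light⇒ π (flip (edge G)) PS PB (b ∸ a) x e
          d : Part → ℕ
          d r = degree π (flip (edge G)) r x
      in member πx , unbalanced-budget {a} {b} {s} {t} {d PA} {d PB} {d PT}
           (degree≤card π (flip (edge G)) PA x) (<⇒≤ a<b) 2d<k S≤T (budget In S-T x πx)

  part-ii : size π PA ≡ 0 → TwoBetween PT PS PT PS
  part-ii A≡0 with m≤n⇒m<n∨m≡n A≤B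
  ... | inj₁ a<b = TS-edges a<b (subst (λ m → 2 * m ≤ b) (trans (sym A≡0) (size≡card π PA)) z≤n)
  ... | inj₂ a≡b = proj₁ (proj₂ (part-i (trans (size≡card π PA) (trans a≡b (sym (size≡card π PB)))) (inj₁ A≡0)))

  part-iii : size π PA ≡ 1 → 2 ≤ size π PB → TwoBetween PT PS PT PS
  part-iii A≡1 B≥2 =
    TS-edges (subst₂ _<_ 1≡a (size≡card π PB) B≥2) (subst₂ (λ m m′ → 2 * m ≤ m′) 1≡a (size≡card π PB) B≥2)
    where
    1≡a : 1 ≡ a
    1≡a = trans (sym A≡1) (size≡card π PA)

conditions : ∀ {η₂ ε₃ n} → η₂ ≤ℚ hundredth → ε₃ ≤ℚ hundredth → 1ℚ ≤ℚ ε₃ *ℚ ⟦ n ⟧ →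
             (G : Digraph n) → MinSemideg≥half G → (π : Fin n → Part) → P1-8 G π ε₃ η₂ → Conditions G π
conditions {η₂} {ε₃} {n} η₂≤ ε₃≤ n-large G δ⁰ π ((A≤B , S≤T) , S-near-half , _ , _ , _ , _ , A-sparse , B-sparse) =
  record
  { n≥100    = ε*n≥1⇒n≥100 n ε₃≤ n-large
  ; S-large  = subst (λ m → 49 * n ≤ 100 * m + 50) (size≡card π PS)
                 (near-half⇒49*n≤ n (size π PS) ε₃≤ (proj₁ S-near-half))
  ; S≤T      = subst₂ _≤_ (size≡card π PS) (size≡card π PT) S≤T
  ; A≤B      = subst₂ _≤_ (size≡card π PA) (size≡card π PB) A≤B
  ; out-half = λ x → half (∣tabulate∣≡count (edge G x)) (proj₁ (δ⁰ x))
  ; in-half  = λ x → half (∣tabulate∣≡count (flip (edge G) x)) (proj₂ (δ⁰ x))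
  ; A-sparse = λ x πx → let _ , _ , in-S , out-T = A-sparse x πx in sparse in-S , sparse out-T
  ; B-sparse = λ x πx → let _ , _ , in-T , out-S = B-sparse x πx in sparse out-S , sparse in-T
  }
  where
  half : ∀ {d c} → d ≡ c → ⟦ n ⟧ *ℚ ½ ≤ℚ ⟦ d ⟧ → n ≤ 2 * c
  half {d} refl = half≤⇒≤2* n d
  sparse : ∀ {f : Fin n → Bool} → ⟦ ∣ tabulate f ∣ ⟧ ≤ℚ ⟦ 3 ⟧ *ℚ η₂ *ℚ ⟦ n ⟧ → 100 * count f ≤ 3 * n
  sparse {f} h = subst (λ d → 100 * d ≤ 3 * n) (∣tabulate∣≡count f) (sparse⇒100*≤3*n n ∣ tabulate f ∣ η₂≤ h)

proposition5p3 :
    Σ (ℚ → ℚ) λ f₀ → Σ (ℚ → ℚ) λ f₁ → Σ (ℚ → ℚ) λ f₂ → Σ (ℚ → ℚ) λ f₃ →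
    HierFun f₀ × HierFun f₁ × HierFun f₂ × HierFun f₃ ×
    (∀ (η₂ ε₄ ε₃ : ℚ) (n : ℕ) →
      Positive η₂ → Positive ε₄ → Positive ε₃ →
      η₂ ≤ℚ f₃ 1ℚ → ε₄ ≤ℚ f₂ η₂ → ε₃ ≤ℚ f₁ ε₄ → 1ℚ ≤ℚ f₀ ε₃ *ℚ ⟦ n ⟧ →
      (G : Digraph n) → MinSemideg≥half G →
      (π : Fin n → Part) → P1-8 G π ε₃ η₂ →
        (size π PA ≡ size π PB → (size π PA ≡ 0 ⊎ size π PA ≡ 1) →
            TwoDisjointEdges G (Between π PS PT) (Between π PS PT)
          × TwoDisjointEdges G (Between π PT PS) (Between π PT PS)
          × TwoDisjointEdges G (Between π PS PT) (Between π PT PS))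
      × (size π PA ≡ 0 → TwoDisjointEdges G (Between π PT PS) (Between π PT PS))
      × (size π PA ≡ 1 → 2 ≤ size π PB → TwoDisjointEdges G (Between π PT PS) (Between π PT PS))
      × TwoDisjointEdges G
          (λ x y → Between π PS PT x y ⊎ Between π PS PA x y ⊎ Between π PT PS x y ⊎ Between π PT PB x y)
          (λ x y → Between π PS PT x y ⊎ Between π PS PA x y ⊎ Between π PT PS x y ⊎ Between π PT PB x y))
proposition5p3 = id , id , id , const hundredth , id-hier , id-hier , id-hier , const-hier ,
  λ η₂ ε₄ ε₃ n _ _ _ η₂≤ ε₄≤η₂ ε₃≤ε₄ n-large G δ⁰ π P →
    let c = conditions η₂≤ (ℚ.≤-trans ε₃≤ε₄ (ℚ.≤-trans ε₄≤η₂ η₂≤)) n-large G δ⁰ π P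
    in part-i c , part-ii c , part-iii c , part-iv c
  where
  id-hier : HierFun id
  id-hier = (λ _ pos → pos) , (λ _ _ _ x≤y → x≤y)
  const-hier : HierFun (const hundredth)
  const-hier = (λ _ _ → ℚ.positive⁻¹ hundredth) , (λ _ _ _ _ → ℚ.≤-refl)
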